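{- Let $(G_x,\mathrm{lab}_x)=\eta_{i,j}(G_y,\mathrm{lab}_y)$ for labels $i\ne j\in[k]$, where $G_y$ contains no vertex $v$ with $\{i,j\}\subseteq\mathrm{lab}_y(v)$, and let $\mathcal{S}_y$ be the set of footprints of $(G_y,\mathrm{lab}_y)$. Then the set of footprints of $(G_x,\mathrm{lab}_x)$ is $\mathcal{S}_x=\{(I,\ \psi[i\mapsto\psi(i)-r,\ j\mapsto\psi(j)-r],\ \ell+r) : (I,\psi,\ell)\in\mathcal{S}_y,\ \{i,j\}\not\subseteq I,\ r\in[\min\{\psi(i),\psi(j)\}]_0\}$.
   Context: Fix a graph $G$ on $n$ vertices; all labeled graphs considered have at most $n$ vertices. $[m]_0=\{0,1,\dots,m\}$. $\eta_{i,j}$ adds all edges $uv$ with $i\in\mathrm{lab}(u)$, $j\in\mathrm{lab}(v)$, keeping labels. For a function $f$, $f[a_1\mapsto b_1,a_2\mapsto b_2]$ agrees with $f$ except mapping $a_1$ to $b_1$ and $a_2$ to $b_2$. For a multi-$k$-labeled graph $(H,\mathrm{lab})$ ($\mathrm{lab}:V(H)\to2^{[k]}$), a partial solution is a pair $(S,M)$ where $S$ is a vertex cover of $H$ and $M$ a matching of $H$ with $V(M)\subseteq S$. A label choice for $(S,M)$ is $\phi:S\setminus V(M)\to[k]$ with $\phi(w)\in\mathrm{lab}(w)$. The footprint of $(S,M)$ and $\phi$ is $(I,\psi,\ell)$ with $I=\bigcup_{w\in V(H)\setminus S}\mathrm{lab}(w)$, $\psi:[k]\to[n]_0$, $\psi(t)=|\phi^{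 -1}(t)|$, $\ell=|M|$. The set of footprints of $(H,\mathrm{lab})$ is the set of footprints over all partial solutions and all their label choices. -}

module Defs where

open import Data.Nat using (ℕ; zero; suc; _+_; _∸_; _≤_)
open import Data.Bool using (Bool; true; false; _∧_; _∨_; not; if_then_else_)
open import Data.Fin using (Fin; _≟_)
open import Data.Fin.Subset using (Subset; _∈_; _∉_)
open import Data.Vec using (Vec; lookup; tabulate)
open import Data.List using (List; []; _∷_; length; map; allFin; concatMap)
open import Data.Nat.ListAction using (sum)
open import Data.Bool.ListAction using (any)
open import Data.List.Relation.Unary.All using (All)
open import Data.List.Relation.Unary.Unique.Propositional using (Unique)
import Data.List.Membership.Propositional as LMem
import Data.List.Membership.DecPropositional as DMem
open import Data.Product using (Σ; ∃; _×_; _,_; proj₁; proj₂)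
open import Data.Sum using (_⊎_)
open import Relation.Nullary using (¬_; ⌊_⌋)
open import Relation.Binary.PropositionalEquality using (_≡_; _≢_)

-- The edge set is the
-- symmetric, loop-free closure of the Boolean relation 'adj' (see Edge below),
-- so every simple graph is representable.
record LGraph (k : ℕ) : Set where
  field
    size : ℕ
    adj  : Fin size → Fin size → Bool
    lab  : Fin size → Subset k
open LGraph public

Edge : ∀ {k} (H : LGraph k) → Fin (size H) → Fin (size H) → Set
Edge H u v = u ≢ v × (adj H u v ≡ true ⊎ adj H v u ≡ true)

η : ∀ {k} → Fin k → Fin k → LGraph k → LGraph k
η i j H = record
  { size = size H
  ; adj  = λ u v → adj H u v ∨ (lookup (lab H u) i ∧ lookup (lab H v) j)
  ; lab  = lab H
  }

endpoints : ∀ {m} → List (Fin m × Fin m) → List (Fin m)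
endpoints = concatMap (λ e → proj₁ e ∷ proj₂ e ∷ [])

countV : ∀ {m} → (Fin m → Bool) → ℕ
countV {m} p = sum (map (λ w → if p w then 1 else 0) (allFin m))

freeLabels : ∀ {k} (H : LGraph k) → Subset (size H) → Subset k
freeLabels H S = tabulate (λ t → any (λ w → not (lookup S w) ∧ lookup (lab H w) t) (allFin (size H)))

choiceCount : ∀ {k} (H : LGraph k) → Subset (size H) → List (Fin (size H) × Fin (size H))
            → (Fin (size H) → Fin k) → Fin k → ℕ
choiceCount H S M φ t =
  countV (λ w → lookup S w ∧ not ⌊ DMem._∈?_ (_≟_ {size H}) w (endpoints M) ⌋ ∧ ⌊ φ w ≟ t ⌋)

Footprint : ℕ → Set
Footprint k = Subset k × (Fin k → ℕ) × ℕ

-- (I , ψ , ℓ) is a footprint of H: there are a partial solution (S , M)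
-- (S a vertex cover, M a matching as a list of vertex-disjoint edges,
-- V(M) ⊆ S) and a label choice φ for it (φ is total, only its values on
-- S \ V(M) matter) with footprint (I , ψ , ℓ).
IsFootprint : ∀ {k} (H : LGraph k) → Footprint k → Set
IsFootprint {k} H (I , ψ , ℓ) =
  Σ (Subset (size H)) λ S →
  Σ (List (Fin (size H) × Fin (size H))) λ M →
  Σ (Fin (size H) → Fin k) λ φ →
      (∀ u v → Edge H u v → u ∈ S ⊎ v ∈ S)
    × All (λ e → Edge H (proj₁ e) (proj₂ e)) M
    × Unique (endpoints M)
    × All (λ w → w ∈ S) (endpoints M)
    × (∀ w → w ∈ S → ¬ (w LMem.∈ endpoints M) → φ w ∈ lab H w)
    × I ≡ freeLabels H S
    × (∀ t → ψ t ≡ choiceCount H S M φ t)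
    × ℓ ≡ length M

shift : ∀ {k} → Fin k → Fin k → (Fin k → ℕ) → ℕ → Fin k → ℕ
shift i j ψ r t =
  if ⌊ t ≟ i ⌋ then ψ i ∸ r else (if ⌊ t ≟ j ⌋ then ψ j ∸ r else ψ t)

InSx : ∀ {k} → Fin k → Fin k → LGraph k → Footprint k → Set
InSx i j Gy (I , ψ , ℓ) =
  Σ (Fin _ → ℕ) λ ψ' → Σ ℕ λ ℓ' → Σ ℕ λ r →
      IsFootprint Gy (I , ψ' , ℓ')
    × ¬ (i ∈ I × j ∈ I)
    × r ≤ ψ' i × r ≤ ψ' j
    × (∀ t → ψ t ≡ shift i j ψ' r t)
    × ℓ ≡ ℓ' + r

-- An edge of η i j Gy is either an edge of Gy or a new edge joining a vertex labelled i
-- to one labelled j.  Splitting the matching of a solution of η i j Gy accordingly and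
-- releasing its r new edges, each endpoint choosing its label among i and j (no vertex has
-- both), gives a solution of Gy whose ψ is larger by r at i and at j and which has the same
-- free labels I.  Conversely, any r unmatched vertices choosing i and r choosing j can be
-- paired into r new matching edges.  A vertex cover of Gy covers the new edges exactly when
-- i and j are not both free labels.

module Submission where

open import Defs
open import Data.Nat using (ℕ; suc; _+_; _*_; _∸_; _≤_; _⊓_)
open import Data.Nat.Properties
  using ( suc-injective; +-assoc; +-comm; +-identityʳ; *-identityʳ; *-zeroʳ; m+n∸n≡m; m≤n+m
        ; m≤n⇒m⊓n≡m; ⊓-idem; +-commutativeSemigroup)
open import Algebra.Properties.CommutativeSemigroup +-commutativeSemigroup using (interchange)
open import Data.Nat.ListAction using (sum)
open import Data.Bool using (Bool; true; false; _∧_; _∨_; not; if_then_else_; T; T?)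
open import Data.Bool.Properties using (T-≡; T-∧; T-not-≡; ∧-conicalˡ; ∧-conicalʳ; ∨-zeroʳ)
open import Data.Bool.ListAction using (any)
open import Data.Fin using (Fin; _≟_)
open import Data.Fin.Subset using (Subset; _∈_)
open import Data.Vec using (lookup)
open import Data.Vec.Properties using (lookup∘tabulate; []=⇒lookup; lookup⇒[]=)
open import Data.List using (List; []; _∷_; _++_; map; allFin; length; filter; filterᵇ; take; zip)
open import Data.List.Properties using (length-++; length-take; length-zipWith; concatMap-++)
open import Data.List.Membership.Propositional using (lose) renaming (_∈_ to _∈ₗ_; _∉_ to _∉ₗ_)
open import Data.List.Membership.Propositional.Properties using (∈-allFin; ∈-++⁺ˡ; ∈-++⁺ʳ; ∈-++⁻)
import Data.List.Membership.DecPropositional as DecMembership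
open import Data.List.Relation.Unary.All as All using (All; []; _∷_)
import Data.List.Relation.Unary.All.Properties as All
open import Data.List.Relation.Unary.Any as Any using (here; there)
open import Data.List.Relation.Unary.Any.Properties using (any⁺; any⁻)
open import Data.List.Relation.Unary.Unique.Propositional using (Unique; []; _∷_)
import Data.List.Relation.Unary.Unique.Propositional.Properties as Unique
open import Data.List.Relation.Binary.Disjoint.Propositional using (Disjoint)
open import Data.List.Relation.Binary.Permutation.Propositional using (↭-sym; ↭⇒↭ₛ)
open import Data.List.Relation.Binary.Permutation.Propositional.Properties using (∈-resp-↭)
import Data.List.Relation.Binary.Permutation.Setoid.Properties as SetoidPermutation
open import Data.List.Relation.Ternary.Interleaving.Propositional
  using (Interleaving; []; consˡ; consʳ; toPermutation)
open import Data.List.Relation.Ternary.Interleaving.Propositional.Properties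
  using (interleave-length; ++-linear; filter⁺)
open import Data.Product using (∃-syntax; _×_; _,_; proj₁; proj₂)
open import Data.Sum using (_⊎_; inj₁; inj₂; [_,_]′; swap)
open import Data.Unit using (tt)
open import Function using (_∘_; _⇔_; mk⇔; Equivalence)
open import Relation.Nullary using (¬_; ⌊_⌋; yes; no; Dec; ¬?)
open import Relation.Nullary.Negation using (contradiction)
open import Relation.Unary using (Decidable)
open import Relation.Binary.PropositionalEquality

ind : Bool → ℕ
ind b = if b then 1 else 0

count : ∀ {A : Set} → (A → Bool) → List A → ℕ
count p xs = sum (map (λ x → ind (p x)) xs)

module _ {A : Set} where

  count-+ : ∀ (p q r : A → Bool) → (∀ x → ind (p x) + ind (q x) ≡ ind (r x)) →
            ∀ xs → count p xs + count q xs ≡ count r xs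
  count-+ p q r pq≡r [] = refl
  count-+ p q r pq≡r (x ∷ xs) = begin
    (ind (p x) + count p xs) + (ind (q x) + count q xs) ≡⟨ interchange (ind (p x)) _ _ _ ⟩
    (ind (p x) + ind (q x)) + (count p xs + count q xs) ≡⟨ cong₂ _+_ (pq≡r x) (count-+ p q r pq≡r xs) ⟩
    ind (r x) + count r xs                              ∎
    where open ≡-Reasoning

  count-false : ∀ (p : A → Bool) xs → (∀ x → x ∈ₗ xs → p x ≡ false) → count p xs ≡ 0
  count-false p [] _ = refl
  count-false p (x ∷ xs) p≡false rewrite p≡false x (here refl) =
    count-false p xs (λ y y∈ → p≡false y (there y∈))

  length-filterᵇ : ∀ (p : A → Bool) xs → length (filterᵇ p xs) ≡ count p xs
  length-filterᵇ p [] = refl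
  length-filterᵇ p (x ∷ xs) with p x
  ... | true  = cong suc (length-filterᵇ p xs)
  ... | false = length-filterᵇ p xs

_∈?_ : ∀ {m} (w : Fin m) (xs : List (Fin m)) → Dec (w ∈ₗ xs)
_∈?_ {m} = DecMembership._∈?_ (_≟_ {m})

module _ {m : ℕ} where

  count-≟ : ∀ (p : Fin m → Bool) {x} xs → Unique xs → x ∈ₗ xs →
            count (λ w → ⌊ w ≟ x ⌋ ∧ p w) xs ≡ ind (p x)
  count-≟ p {x} (.x ∷ xs) x∷xs! (here refl) with x ≟ x
  ... | no x≢x = contradiction refl x≢x
  ... | yes _  = trans (cong (ind (p x) +_) (count-false _ xs others)) (+-identityʳ _)
    where
    others : ∀ w → w ∈ₗ xs → (⌊ w ≟ x ⌋ ∧ p w) ≡ false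
    others w w∈ with w ≟ x
    ... | yes refl = contradiction w∈ (Unique.Unique[x∷xs]⇒x∉xs x∷xs!)
    ... | no _     = refl
  count-≟ p {x} (y ∷ xs) y∷xs!@(_ ∷ xs!) (there x∈) with y ≟ x
  ... | yes refl = contradiction x∈ (Unique.Unique[x∷xs]⇒x∉xs y∷xs!)
  ... | no _     = count-≟ p xs xs! x∈

  count-∈? : ∀ (p : Fin m → Bool) L → Unique L →
             count (λ w → ⌊ w ∈? L ⌋ ∧ p w) (allFin m) ≡ count p L
  count-∈? p [] _ = count-false _ (allFin m) (λ _ _ → refl)
  count-∈? p (x ∷ L) x∷L!@(_ ∷ L!) = begin
    count (λ w → ⌊ w ∈? (x ∷ L) ⌋ ∧ p w) (allFin m)
      ≡⟨ sym (count-+ _ _ _ split (allFin m)) ⟩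
    count (λ w → ⌊ w ≟ x ⌋ ∧ p w) (allFin m) + count (λ w → ⌊ w ∈? L ⌋ ∧ p w) (allFin m)
      ≡⟨ cong₂ _+_ (count-≟ p (allFin m) (Unique.allFin⁺ m) (∈-allFin x)) (count-∈? p L L!) ⟩
    ind (p x) + count p L
      ∎
    where
    open ≡-Reasoning
    split : ∀ w → ind (⌊ w ≟ x ⌋ ∧ p w) + ind (⌊ w ∈? L ⌋ ∧ p w)
                  ≡ ind (⌊ w ∈? (x ∷ L) ⌋ ∧ p w)
    split w with w ≟ x | w ∈? L
    ... | yes refl | yes x∈L = contradiction x∈L (Unique.Unique[x∷xs]⇒x∉xs x∷L!)
    ... | yes refl | no _    = +-identityʳ _
    ... | no _     | yes _   = refl
    ... | no _     | no _    = refl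

module _ {A : Set} {l r xs : List A} (sp : Interleaving l r xs) where

  ∈-interleaving⁻ : ∀ {x} → x ∈ₗ xs → x ∈ₗ l ⊎ x ∈ₗ r
  ∈-interleaving⁻ x∈ = ∈-++⁻ l (∈-resp-↭ (toPermutation sp) x∈)

  ∈-interleavingˡ : ∀ {x} → x ∈ₗ l → x ∈ₗ xs
  ∈-interleavingˡ x∈ = ∈-resp-↭ (↭-sym (toPermutation sp)) (∈-++⁺ˡ x∈)

  ∈-interleavingʳ : ∀ {x} → x ∈ₗ r → x ∈ₗ xs
  ∈-interleavingʳ x∈ = ∈-resp-↭ (↭-sym (toPermutation sp)) (∈-++⁺ʳ l x∈)

  Unique-interleaving⁺ : Unique l → Unique r → Disjoint l r → Unique xs
  Unique-interleaving⁺ l! r! l#r = SetoidPermutation.Unique-resp-↭ (setoid A)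
    (↭⇒↭ₛ (↭-sym (toPermutation sp))) (Unique.++⁺ l! r! l#r)

Unique-interleaving⁻ : ∀ {A : Set} {l r xs : List A} → Interleaving l r xs → Unique xs →
                       Unique l × Unique r × Disjoint l r
Unique-interleaving⁻ [] _ = [] , [] , λ ()
Unique-interleaving⁻ (consˡ sp) (x∉xs ∷ xs!) with Unique-interleaving⁻ sp xs!
... | l! , r! , l#r =
  All.tabulate (λ y∈l → All.lookup x∉xs (∈-interleavingˡ sp y∈l)) ∷ l! , r! , disjoint
  where
  disjoint : Disjoint _ _
  disjoint (here refl , x∈r) = All.lookup x∉xs (∈-interleavingʳ sp x∈r) refl
  disjoint (there y∈l , y∈r) = l#r (y∈l , y∈r)
Unique-interleaving⁻ (consʳ sp) (x∉xs ∷ xs!) with Unique-interleaving⁻ sp xs!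
... | l! , r! , l#r =
  l! , All.tabulate (λ y∈r → All.lookup x∉xs (∈-interleavingʳ sp y∈r)) ∷ r! , disjoint
  where
  disjoint : Disjoint _ _
  disjoint (x∈l , here refl) = All.lookup x∉xs (∈-interleavingˡ sp x∈l) refl
  disjoint (y∈l , there y∈r) = l#r (y∈l , y∈r)

module _ {m : ℕ} where

  endpoints-interleaving : ∀ {l r xs : List (Fin m × Fin m)} → Interleaving l r xs →
                           Interleaving (endpoints l) (endpoints r) (endpoints xs)
  endpoints-interleaving []         = []
  endpoints-interleaving (consˡ sp) = consˡ (consˡ (endpoints-interleaving sp))
  endpoints-interleaving (consʳ sp) = consʳ (consʳ (endpoints-interleaving sp))

  endpoints-zip : ∀ (xs ys : List (Fin m)) → length xs ≡ length ys →
                  Interleaving xs ys (endpoints (zip xs ys))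
  endpoints-zip []       []       _ = []
  endpoints-zip (x ∷ xs) (y ∷ ys) eq = consˡ (consʳ (endpoints-zip xs ys (suc-injective eq)))

  ∈-endpoints : ∀ {u v} {N : List (Fin m × Fin m)} → (u , v) ∈ₗ N →
                u ∈ₗ endpoints N × v ∈ₗ endpoints N
  ∈-endpoints (here refl) = here refl , there (here refl)
  ∈-endpoints {N = _ ∷ N} (there uv∈) with ∈-endpoints {N = N} uv∈
  ... | u∈ , v∈ = there (there u∈) , there (there v∈)

  All-endpoints⁺ : ∀ {P : Fin m → Set} {N : List (Fin m × Fin m)} →
                   All (λ e → P (proj₁ e) × P (proj₂ e)) N → All P (endpoints N)
  All-endpoints⁺ [] = []
  All-endpoints⁺ ((pu , pv) ∷ N) = pu ∷ pv ∷ All-endpoints⁺ N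

All-zip : ∀ {A : Set} {P Q : A → Set} {xs ys} → All P xs → All Q ys →
          All (λ e → P (proj₁ e) × Q (proj₂ e)) (zip xs ys)
All-zip (px ∷ pxs) (qy ∷ qys) = (px , qy) ∷ All-zip pxs qys
All-zip []         _          = []
All-zip (_ ∷ _)    []         = []

module _ {m k : ℕ} where

  -- choiceCount H S M φ t unfolds to count (isChosen S (endpoints M) φ t) (allFin (size H)).
  isChosen : Subset m → List (Fin m) → (Fin m → Fin k) → Fin k → Fin m → Bool
  isChosen S E φ t w = lookup S w ∧ not ⌊ w ∈? E ⌋ ∧ ⌊ φ w ≟ t ⌋

  isChosen-sound : ∀ S E φ t w → T (isChosen S E φ t w) → w ∈ S × w ∉ₗ E × φ w ≡ t
  isChosen-sound S E φ t w chosen with lookup S w in S[w] | w ∈? E | φ w ≟ t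
  ... | true | no w∉E | yes φw≡t = lookup⇒[]= w S S[w] , w∉E , φw≡t

  count-isChosen-unmatch : ∀ S {E EN E⁺} (φ φ⁺ : Fin m → Fin k) →
    Interleaving E EN E⁺ → Unique E⁺ → All (_∈ S) EN → (∀ w → w ∉ₗ EN → φ⁺ w ≡ φ w) → ∀ t →
    count (isChosen S E φ t) (allFin m)
      ≡ count (isChosen S E⁺ φ⁺ t) (allFin m) + count (λ w → ⌊ φ w ≟ t ⌋) EN
  count-isChosen-unmatch S {E} {EN} {E⁺} φ φ⁺ sp E⁺! EN⊆S φ⁺≡φ t =
    trans (sym (count-+ _ _ _ pointwise (allFin m)))
          (cong (count (isChosen S E⁺ φ⁺ t) (allFin m) +_) (count-∈? _ EN EN!))
    where
    EN! : Unique EN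
    EN! = proj₁ (proj₂ (Unique-interleaving⁻ sp E⁺!))

    E#EN : Disjoint E EN
    E#EN = proj₂ (proj₂ (Unique-interleaving⁻ sp E⁺!))

    pointwise : ∀ w → ind (isChosen S E⁺ φ⁺ t w) + ind (⌊ w ∈? EN ⌋ ∧ ⌊ φ w ≟ t ⌋)
                      ≡ ind (isChosen S E φ t w)
    pointwise w with w ∈? EN | w ∈? E | w ∈? E⁺
    ... | yes w∈EN | yes w∈E  | _         = contradiction (w∈E , w∈EN) E#EN
    ... | yes w∈EN | no _     | no w∉E⁺   = contradiction (∈-interleavingʳ sp w∈EN) w∉E⁺
    ... | yes w∈EN | no _     | yes _
      rewrite []=⇒lookup (All.lookup EN⊆S w∈EN) = refl
    ... | no w∉EN  | yes w∈E  | no w∉E⁺   = contradiction (∈-interleavingˡ sp w∈E) w∉E⁺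
    ... | no _     | yes _    | yes _     = +-identityʳ _
    ... | no w∉EN  | no _     | no _      rewrite φ⁺≡φ w w∉EN = +-identityʳ _
    ... | no w∉EN  | no w∉E   | yes w∈E⁺  with ∈-interleaving⁻ sp w∈E⁺
    ...   | inj₁ w∈E  = contradiction w∈E w∉E
    ...   | inj₂ w∈EN = contradiction w∈EN w∉EN

module _ {k : ℕ} (i j : Fin k) where

  pairIndicator : Fin k → ℕ
  pairIndicator t = ind ⌊ i ≟ t ⌋ + ind ⌊ j ≟ t ⌋

  Crosses : ∀ {A : Set} → (A → Fin k) → A × A → Set
  Crosses f (a , b) = (f a ≡ i × f b ≡ j) ⊎ (f a ≡ j × f b ≡ i)

  count-endpoints-crossing : ∀ {m} (f : Fin m → Fin k) t N → All (Crosses f) N →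
    count (λ w → ⌊ f w ≟ t ⌋) (endpoints N) ≡ length N * pairIndicator t
  count-endpoints-crossing f t [] [] = refl
  count-endpoints-crossing f t ((a , b) ∷ N) (ab-crosses ∷ N-crosses) =
    trans (sym (+-assoc (ind ⌊ f a ≟ t ⌋) (ind ⌊ f b ≟ t ⌋) _))
          (cong₂ _+_ (edge ab-crosses) (count-endpoints-crossing f t N N-crosses))
    where
    edge : Crosses f (a , b) → ind ⌊ f a ≟ t ⌋ + ind ⌊ f b ≟ t ⌋ ≡ pairIndicator t
    edge (inj₁ (fa≡i , fb≡j)) rewrite fa≡i | fb≡j = refl
    edge (inj₂ (fa≡j , fb≡i)) rewrite fa≡j | fb≡i = +-comm (ind ⌊ j ≟ t ⌋) _

module _ {k : ℕ} {i j : Fin k} (i≢j : i ≢ j) where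

  pairIndicator-i : pairIndicator i j i ≡ 1
  pairIndicator-i with i ≟ i | j ≟ i
  ... | no i≢i | _        = contradiction refl i≢i
  ... | yes _  | yes j≡i  = contradiction (sym j≡i) i≢j
  ... | yes _  | no _     = refl

  pairIndicator-j : pairIndicator i j j ≡ 1
  pairIndicator-j with i ≟ j | j ≟ j
  ... | _       | no j≢j = contradiction refl j≢j
  ... | yes i≡j | _      = contradiction i≡j i≢j
  ... | no _    | yes _  = refl

  pairIndicator-other : ∀ t → t ≢ i → t ≢ j → pairIndicator i j t ≡ 0
  pairIndicator-other t t≢i t≢j with i ≟ t | j ≟ t
  ... | yes i≡t | _       = contradiction (sym i≡t) t≢i
  ... | no _    | yes j≡t = contradiction (sym j≡t) t≢j
  ... | no _    | no _    = refl

  module _ (ψ : Fin k → ℕ) {ψ⁺ : Fin k → ℕ} (r : ℕ)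
           (ψ⁺≡ : ∀ t → ψ⁺ t ≡ ψ t + r * pairIndicator i j t) where

    private
      ψ⁺-on-pair : ∀ t → pairIndicator i j t ≡ 1 → ψ⁺ t ≡ ψ t + r
      ψ⁺-on-pair t t∈ij rewrite ψ⁺≡ t | t∈ij = cong (ψ t +_) (*-identityʳ r)

      ∸-on-pair : ∀ t → pairIndicator i j t ≡ 1 → ψ⁺ t ∸ r ≡ ψ t
      ∸-on-pair t t∈ij rewrite ψ⁺-on-pair t t∈ij = m+n∸n≡m (ψ t) r

    shift-cancels : ∀ t → shift i j ψ⁺ r t ≡ ψ t
    shift-cancels t with t ≟ i | t ≟ j
    ... | yes refl | _        = ∸-on-pair t pairIndicator-i
    ... | no _     | yes refl = ∸-on-pair t pairIndicator-j
    ... | no t≢i   | no t≢j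
      rewrite ψ⁺≡ t | pairIndicator-other t t≢i t≢j | *-zeroʳ r = +-identityʳ (ψ t)

    shift-amount-≤ᵢ : r ≤ ψ⁺ i
    shift-amount-≤ᵢ rewrite ψ⁺-on-pair i pairIndicator-i = m≤n+m r (ψ i)

    shift-amount-≤ⱼ : r ≤ ψ⁺ j
    shift-amount-≤ⱼ rewrite ψ⁺-on-pair j pairIndicator-j = m≤n+m r (ψ j)

VertexCover : ∀ {k} (H : LGraph k) → Subset (size H) → Set
VertexCover H S = ∀ u v → Edge H u v → u ∈ S ⊎ v ∈ S

module _ {k : ℕ} (H : LGraph k) where

  adjacent : Fin (size H) × Fin (size H) → Bool
  adjacent (u , v) = adj H u v ∨ adj H v u

  ∈-freeLabels⁻ : ∀ S t → t ∈ freeLabels H S → ∃[ w ] lookup S w ≡ false × t ∈ lab H w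
  ∈-freeLabels⁻ S t t∈ =
    let w , w-free = Any.satisfied (any⁻ _ (allFin (size H)) free)
        w∉S , t∈w  = Equivalence.to T-∧ w-free
    in  w , Equivalence.to T-not-≡ w∉S , lookup⇒[]= t (lab H w) (Equivalence.to T-≡ t∈w)
    where
    free : T (any (λ w → not (lookup S w) ∧ lookup (lab H w) t) (allFin (size H)))
    free = Equivalence.from T-≡ (trans (sym (lookup∘tabulate _ t)) ([]=⇒lookup t∈))

  ∈-freeLabels⁺ : ∀ S t w → lookup S w ≡ false → t ∈ lab H w → t ∈ freeLabels H S
  ∈-freeLabels⁺ S t w S[w]≡false t∈w = lookup⇒[]= t (freeLabels H S)
    (trans (lookup∘tabulate _ t) (Equivalence.to T-≡ (any⁺ _ (lose (∈-allFin w) w-free))))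
    where
    w-free : T (not (lookup S w) ∧ lookup (lab H w) t)
    w-free = Equivalence.from T-∧
      (Equivalence.from T-not-≡ S[w]≡false , Equivalence.from T-≡ ([]=⇒lookup t∈w))

module _ {k : ℕ} (i j : Fin k) (H : LGraph k) where

  JoinsIJ : Fin (size H) × Fin (size H) → Set
  JoinsIJ (u , v) = (i ∈ lab H u × j ∈ lab H v) ⊎ (j ∈ lab H u × i ∈ lab H v)

  edge-η⁺ : ∀ {u v} → Edge H u v → Edge (η i j H) u v
  edge-η⁺ {u} {v} (u≢v , inj₁ uv) rewrite uv = u≢v , inj₁ refl
  edge-η⁺ {u} {v} (u≢v , inj₂ vu) rewrite vu = u≢v , inj₂ refl

  edge-η-old : ∀ e → Edge (η i j H) (proj₁ e) (proj₂ e) → T (adjacent H e) →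
               Edge H (proj₁ e) (proj₂ e)
  edge-η-old (u , v) (u≢v , _) old with adj H u v | adj H v u
  ... | true  | _    = u≢v , inj₁ refl
  ... | false | true = u≢v , inj₂ refl

  edge-η-new : ∀ e → Edge (η i j H) (proj₁ e) (proj₂ e) → ¬ T (adjacent H e) → JoinsIJ e
  edge-η-new (u , v) (_ , added) new with adj H u v | adj H v u | added
  ... | true  | _     | _        = contradiction tt new
  ... | false | true  | _        = contradiction tt new
  ... | false | false | inj₁ i∧j =
    inj₁ (lookup⇒[]= i (lab H u) (∧-conicalˡ _ _ i∧j) , lookup⇒[]= j (lab H v) (∧-conicalʳ _ _ i∧j))
  ... | false | false | inj₂ j∧i =
    inj₂ (lookup⇒[]= j (lab H u) (∧-conicalʳ _ _ j∧i) , lookup⇒[]= i (lab H v) (∧-conicalˡ _ _ j∧i))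

  joinsIJ⇒edge-η : ∀ {u v} → u ≢ v → JoinsIJ (u , v) → Edge (η i j H) u v
  joinsIJ⇒edge-η {u} {v} u≢v (inj₁ (i∈u , j∈v))
    rewrite []=⇒lookup i∈u | []=⇒lookup j∈v | ∨-zeroʳ (adj H u v) = u≢v , inj₁ refl
  joinsIJ⇒edge-η {u} {v} u≢v (inj₂ (j∈u , i∈v))
    rewrite []=⇒lookup i∈v | []=⇒lookup j∈u | ∨-zeroʳ (adj H v u) = u≢v , inj₂ refl

lookup≡false⇒∉ : ∀ {m} {S : Subset m} {w} → lookup S w ≡ false → ¬ w ∈ S
lookup≡false⇒∉ S[w]≡false w∈S with trans (sym ([]=⇒lookup w∈S)) S[w]≡false
... | ()

module _ {k : ℕ} {i j : Fin k} {H : LGraph k} {S : Subset (size H)} where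

  private
    NotBothFree : Set
    NotBothFree = ¬ (i ∈ freeLabels H S × j ∈ freeLabels H S)

    joined-covered : NotBothFree → ∀ {a b} → i ∈ lab H a → j ∈ lab H b → a ∈ S ⊎ b ∈ S
    joined-covered notBoth {a} {b} i∈a j∈b with lookup S a in S[a] | lookup S b in S[b]
    ... | true  | _     = inj₁ (lookup⇒[]= a S S[a])
    ... | false | true  = inj₂ (lookup⇒[]= b S S[b])
    ... | false | false = contradiction
      (∈-freeLabels⁺ H S i a S[a] i∈a , ∈-freeLabels⁺ H S j b S[b] j∈b) notBoth

  cover-η⁺ : VertexCover H S → NotBothFree → VertexCover (η i j H) S
  cover-η⁺ cover notBoth u v uv with T? (adjacent H (u , v))
  ... | yes old = cover u v (edge-η-old i j H (u , v) uv old)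
  ... | no new with edge-η-new i j H (u , v) uv new
  ...   | inj₁ (i∈u , j∈v) = joined-covered notBoth i∈u j∈v
  ...   | inj₂ (j∈u , i∈v) = swap (joined-covered notBoth i∈v j∈u)

  cover-η⁻ : (∀ v → ¬ (i ∈ lab H v × j ∈ lab H v)) → VertexCover (η i j H) S →
             VertexCover H S × NotBothFree
  cover-η⁻ noBoth cover = (λ u v uv → cover u v (edge-η⁺ i j H uv)) , notBoth
    where
    notBoth : NotBothFree
    notBoth (i-free , j-free) with ∈-freeLabels⁻ H S i i-free | ∈-freeLabels⁻ H S j j-free
    ... | a , S[a] , i∈a | b , S[b] , j∈b
      with cover a b (joinsIJ⇒edge-η i j H (λ { refl → noBoth a (i∈a , j∈b) }) (inj₁ (i∈a , j∈b)))
    ...   | inj₁ a∈S = lookup≡false⇒∉ S[a] a∈S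
    ...   | inj₂ b∈S = lookup≡false⇒∉ S[b] b∈S

choiceCount-unmatch : ∀ {k} {i j : Fin k} (H : LGraph k) S {M N M⁺} (φ φ⁺ : Fin (size H) → Fin k) →
  Interleaving (endpoints M) (endpoints N) (endpoints M⁺) → Unique (endpoints M⁺) →
  All (_∈ S) (endpoints N) → (∀ w → w ∉ₗ endpoints N → φ⁺ w ≡ φ w) → All (Crosses i j φ) N →
  ∀ t → choiceCount H S M φ t ≡ choiceCount H S M⁺ φ⁺ t + length N * pairIndicator i j t
choiceCount-unmatch {i = i} {j} H S {N = N} {M⁺} φ φ⁺ sp M⁺! N⊆S φ⁺≡φ N-crosses t =
  trans (count-isChosen-unmatch S φ φ⁺ sp M⁺! N⊆S φ⁺≡φ t)
        (cong (choiceCount H S M⁺ φ⁺ t +_) (count-endpoints-crossing i j φ t N N-crosses))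

module _ {k : ℕ} {i j : Fin k} (i≢j : i ≢ j) {Gy : LGraph k}
         (noBoth : ∀ v → ¬ (i ∈ lab Gy v × j ∈ lab Gy v)) where

  private
    m = size Gy

    Labelled : Fin m → Set
    Labelled w = i ∈ lab Gy w ⊎ j ∈ lab Gy w

    -- On an endpoint of a new edge this is its unique label among i and j.
    choose : Fin m → Fin k
    choose w = if lookup (lab Gy w) i then i else j

    choose-i : ∀ {w} → i ∈ lab Gy w → choose w ≡ i
    choose-i {w} i∈w rewrite []=⇒lookup i∈w = refl

    choose-j : ∀ {w} → j ∈ lab Gy w → choose w ≡ j
    choose-j {w} j∈w with lookup (lab Gy w) i in w[i]
    ... | true  = contradiction (lookup⇒[]= i (lab Gy w) w[i] , j∈w) (noBoth w)
    ... | false = refl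

    choose-∈ : ∀ {w} → Labelled w → choose w ∈ lab Gy w
    choose-∈ (inj₁ i∈w) rewrite choose-i i∈w = i∈w
    choose-∈ (inj₂ j∈w) rewrite choose-j j∈w = j∈w

    joins-labelled : ∀ e → JoinsIJ i j Gy e → Labelled (proj₁ e) × Labelled (proj₂ e)
    joins-labelled _ (inj₁ (i∈u , j∈v)) = inj₁ i∈u , inj₂ j∈v
    joins-labelled _ (inj₂ (j∈u , i∈v)) = inj₂ j∈u , inj₁ i∈v

  footprint-η⇒InSx : ∀ F → IsFootprint (η i j Gy) F → InSx i j Gy F
  footprint-η⇒InSx (I , ψ , ℓ) (S , M , φ , cover , M-edges , M! , M⊆S , φ-lab , I≡ , ψ≡ , ℓ≡) =
    ψ' , length M' , length N ,
    (S , M' , φ' , cover' , M'-edges , M'! , M'⊆S , φ'-lab , I≡ , (λ _ → refl) , refl) ,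
    subst (λ I → ¬ (i ∈ I × j ∈ I)) (sym I≡) notBoth ,
    shift-amount-≤ᵢ i≢j ψ (length N) ψ'≡ , shift-amount-≤ⱼ i≢j ψ (length N) ψ'≡ ,
    (λ t → sym (shift-cancels i≢j ψ (length N) ψ'≡ t)) ,
    trans ℓ≡ (interleave-length {A = Fin m × Fin m} {B = Fin m × Fin m} sp)
    where
    old? : Decidable (T ∘ adjacent Gy)
    old? = T? ∘ adjacent Gy

    M' N : List (Fin m × Fin m)
    M' = filter old? M
    N = filter (¬? ∘ old?) M

    sp : Interleaving M' N M
    sp = filter⁺ old? M

    spE : Interleaving (endpoints M') (endpoints N) (endpoints M)
    spE = endpoints-interleaving sp

    M'! : Unique (endpoints M')
    M'! = proj₁ (Unique-interleaving⁻ spE M!)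

    φ' : Fin m → Fin k
    φ' w = if ⌊ w ∈? endpoints N ⌋ then choose w else φ w

    φ'-on-N : ∀ {w} → w ∈ₗ endpoints N → φ' w ≡ choose w
    φ'-on-N {w} w∈N with w ∈? endpoints N
    ... | yes _   = refl
    ... | no w∉N  = contradiction w∈N w∉N

    φ'-off-N : ∀ w → w ∉ₗ endpoints N → φ w ≡ φ' w
    φ'-off-N w w∉N with w ∈? endpoints N
    ... | yes w∈N = contradiction w∈N w∉N
    ... | no _    = refl

    cover' : VertexCover Gy S
    cover' = proj₁ (cover-η⁻ noBoth cover)

    notBoth : ¬ (i ∈ freeLabels Gy S × j ∈ freeLabels Gy S)
    notBoth = proj₂ (cover-η⁻ noBoth cover)

    M'-edges : All (λ e → Edge Gy (proj₁ e) (proj₂ e)) M'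
    M'-edges = All.zipWith (λ {e} (uv , old) → edge-η-old i j Gy e uv old)
                           (All.filter⁺ old? M-edges , All.all-filter old? M)

    N-joins : All (JoinsIJ i j Gy) N
    N-joins = All.zipWith (λ {e} (uv , new) → edge-η-new i j Gy e uv new)
                          (All.filter⁺ (¬? ∘ old?) M-edges , All.all-filter (¬? ∘ old?) M)

    N-labelled : All Labelled (endpoints N)
    N-labelled = All-endpoints⁺ (All.map (joins-labelled _) N-joins)

    N-crosses : All (Crosses i j φ') N
    N-crosses = All.tabulate crosses
      where
      crosses : ∀ {e} → e ∈ₗ N → Crosses i j φ' e
      crosses {u , v} uv∈N with ∈-endpoints uv∈N | All.lookup N-joins uv∈N
      ... | u∈ , v∈ | inj₁ (i∈u , j∈v) =
        inj₁ (trans (φ'-on-N u∈) (choose-i i∈u) , trans (φ'-on-N v∈) (choose-j j∈v))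
      ... | u∈ , v∈ | inj₂ (j∈u , i∈v) =
        inj₂ (trans (φ'-on-N u∈) (choose-j j∈u) , trans (φ'-on-N v∈) (choose-i i∈v))

    M'⊆S : All (_∈ S) (endpoints M')
    M'⊆S = All.tabulate (All.lookup M⊆S ∘ ∈-interleavingˡ spE)

    N⊆S : All (_∈ S) (endpoints N)
    N⊆S = All.tabulate (All.lookup M⊆S ∘ ∈-interleavingʳ spE)

    φ'-lab : ∀ w → w ∈ S → w ∉ₗ endpoints M' → φ' w ∈ lab Gy w
    φ'-lab w w∈S w∉M' with w ∈? endpoints N
    ... | yes w∈N = choose-∈ (All.lookup N-labelled w∈N)
    ... | no w∉N  = φ-lab w w∈S ([ w∉M' , w∉N ]′ ∘ ∈-interleaving⁻ spE)

    ψ' : Fin k → ℕ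
    ψ' = choiceCount Gy S M' φ'

    ψ'≡ : ∀ t → ψ' t ≡ ψ t + length N * pairIndicator i j t
    ψ'≡ t = trans (choiceCount-unmatch Gy S {M'} {N} {M} φ' φ spE M! N⊆S φ'-off-N N-crosses t)
                  (cong (_+ length N * pairIndicator i j t) (sym (ψ≡ t)))

  InSx⇒footprint-η : ∀ F → InSx i j Gy F → IsFootprint (η i j Gy) F
  InSx⇒footprint-η (I , ψ , ℓ)
    (ψ' , ℓ' , r , (S , M , φ , cover , M-edges , M! , M⊆S , φ-lab , I≡ , ψ'≡ , ℓ'≡) ,
     notBoth , r≤ψ'i , r≤ψ'j , ψ≡ , ℓ≡) =
    S , M ++ N , φ ,
    cover-η⁺ {H = Gy} cover (subst (λ I → ¬ (i ∈ I × j ∈ I)) I≡ notBoth) ,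
    All.++⁺ (All.map (edge-η⁺ i j Gy) M-edges) N-edges ,
    M⁺! , M⁺⊆S , (λ w w∈S w∉M⁺ → φ-lab w w∈S (w∉M⁺ ∘ ∈-interleavingˡ sp)) , I≡ , ψ≡⁺ , ℓ≡⁺
    where
    E : List (Fin m)
    E = endpoints M

    Picked : Fin k → Fin m → Set
    Picked t w = w ∈ S × w ∉ₗ E × φ w ≡ t

    picked : Fin k → List (Fin m)
    picked t = take r (filterᵇ (isChosen S E φ t) (allFin m))

    picked-sound : ∀ t → All (Picked t) (picked t)
    picked-sound t = All.map (isChosen-sound S E φ t _)
      (All.take⁺ r (All.all-filter (T? ∘ isChosen S E φ t) (allFin m)))

    picked! : ∀ t → Unique (picked t)
    picked! t = Unique.take⁺ r (Unique.filter⁺ (T? ∘ isChosen S E φ t) (Unique.allFin⁺ m))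

    length-picked : ∀ t → r ≤ ψ' t → length (picked t) ≡ r
    length-picked t r≤ψ't = trans (length-take r _) (m≤n⇒m⊓n≡m
      (subst (r ≤_) (trans (ψ'≡ t) (sym (length-filterᵇ (isChosen S E φ t) (allFin m)))) r≤ψ't))

    N : List (Fin m × Fin m)
    N = zip (picked i) (picked j)

    length-N : length N ≡ r
    length-N = begin
      length N
        ≡⟨ length-zipWith _,_ (picked i) (picked j) ⟩
      length (picked i) ⊓ length (picked j)
        ≡⟨ cong₂ _⊓_ (length-picked i r≤ψ'i) (length-picked j r≤ψ'j) ⟩
      r ⊓ r
        ≡⟨ ⊓-idem r ⟩
      r ∎
      where open ≡-Reasoning

    spN : Interleaving (picked i) (picked j) (endpoints N)
    spN = endpoints-zip (picked i) (picked j)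
            (trans (length-picked i r≤ψ'i) (sym (length-picked j r≤ψ'j)))

    N-picked : ∀ {w} → w ∈ₗ endpoints N → w ∈ S × w ∉ₗ E
    N-picked w∈N with ∈-interleaving⁻ spN w∈N
    ... | inj₁ w∈i = let (w∈S , w∉E , _) = All.lookup (picked-sound i) w∈i in w∈S , w∉E
    ... | inj₂ w∈j = let (w∈S , w∉E , _) = All.lookup (picked-sound j) w∈j in w∈S , w∉E

    N! : Unique (endpoints N)
    N! = Unique-interleaving⁺ spN (picked! i) (picked! j) λ (w∈i , w∈j) →
      let (_ , _ , φw≡i) = All.lookup (picked-sound i) w∈i
          (_ , _ , φw≡j) = All.lookup (picked-sound j) w∈j
      in  i≢j (trans (sym φw≡i) φw≡j)

    N-pairs : All (λ e → Picked i (proj₁ e) × Picked j (proj₂ e)) N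
    N-pairs = All-zip (picked-sound i) (picked-sound j)

    N-crosses : All (Crosses i j φ) N
    N-crosses = All.map (λ ((_ , _ , φa≡i) , (_ , _ , φb≡j)) → inj₁ (φa≡i , φb≡j)) N-pairs

    N-edges : All (λ e → Edge (η i j Gy) (proj₁ e) (proj₂ e)) N
    N-edges = All.map edge N-pairs
      where
      edge : ∀ {e} → Picked i (proj₁ e) × Picked j (proj₂ e) → Edge (η i j Gy) (proj₁ e) (proj₂ e)
      edge {a , b} ((a∈S , a∉E , φa≡i) , (b∈S , b∉E , φb≡j)) =
        joinsIJ⇒edge-η i j Gy (λ { refl → i≢j (trans (sym φa≡i) φb≡j) })
          (inj₁ ( subst (_∈ lab Gy a) φa≡i (φ-lab a a∈S a∉E)
                , subst (_∈ lab Gy b) φb≡j (φ-lab b b∈S b∉E)))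

    sp : Interleaving E (endpoints N) (endpoints (M ++ N))
    sp = subst (Interleaving E (endpoints N)) (sym (concatMap-++ _ M N)) (++-linear E (endpoints N))

    M⁺! : Unique (endpoints (M ++ N))
    M⁺! = Unique-interleaving⁺ sp M! N! λ (w∈E , w∈N) → proj₂ (N-picked w∈N) w∈E

    M⁺⊆S : All (_∈ S) (endpoints (M ++ N))
    M⁺⊆S = All.tabulate ([ All.lookup M⊆S , proj₁ ∘ N-picked ]′ ∘ ∈-interleaving⁻ sp)

    ψ'≡⁺ : ∀ t → ψ' t ≡ choiceCount Gy S (M ++ N) φ t + r * pairIndicator i j t
    ψ'≡⁺ t = begin
      ψ' t
        ≡⟨ ψ'≡ t ⟩
      choiceCount Gy S M φ t
        ≡⟨ choiceCount-unmatch Gy S {M} {N} {M ++ N} φ φ sp M⁺! (All.tabulate (proj₁ ∘ N-picked))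
                               (λ _ _ → refl) N-crosses t ⟩
      choiceCount Gy S (M ++ N) φ t + length N * pairIndicator i j t
        ≡⟨ cong (λ n → choiceCount Gy S (M ++ N) φ t + n * pairIndicator i j t) length-N ⟩
      choiceCount Gy S (M ++ N) φ t + r * pairIndicator i j t
        ∎
      where open ≡-Reasoning

    ψ≡⁺ : ∀ t → ψ t ≡ choiceCount Gy S (M ++ N) φ t
    ψ≡⁺ t = trans (ψ≡ t) (shift-cancels i≢j _ r ψ'≡⁺ t)

    ℓ≡⁺ : ℓ ≡ length (M ++ N)
    ℓ≡⁺ = begin
      ℓ                     ≡⟨ ℓ≡ ⟩
      ℓ' + r                ≡⟨ cong₂ _+_ ℓ'≡ (sym length-N) ⟩
      length M + length N   ≡⟨ sym (length-++ M) ⟩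
      length (M ++ N)       ∎
      where open ≡-Reasoning

mainTheorem15 : (k : ℕ) (i j : Fin k) → i ≢ j → (Gy : LGraph k)
    → (∀ v → ¬ (i ∈ lab Gy v × j ∈ lab Gy v))
    → (F : Footprint k) → IsFootprint (η i j Gy) F ⇔ InSx i j Gy F
mainTheorem15 k i j i≢j Gy noBoth F =
  mk⇔ (footprint-η⇒InSx i≢j noBoth F) (InSx⇒footprint-η i≢j noBoth F)
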